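{- Let $S = (G,T,C)$ be a stochastic abelian sandpile which is irreducible, i.e. for every ordinary site $v$ and every toppling rule $t \in T(v)$, $t$ contains at least one ordinary site. Then the empty configuration (zero particles at every ordinary site) is transient, i.e. it is not reachable from $c_{\max}$.
   Context: A stochastic abelian sandpile is a triple $S=(G,T,C)$: $G$ is a finite connected multigraph with a designated sink $s$ and ordinary sites $V_o = V(G)\setminus\{s\}$; $C: V_o \to \mathbb{Z}_{>0}$ is the capacity (toppling threshold); for each $v\in V_o$, $T(v)$ is a collection of toppling rules, each a multiset of ordinary neighbours of $v$ with at most $C(v)$ elements, and every edge incident to $v$ appears in some rule of $T(v)$. A configuration is a map $c: V_o\to\mathbb{N}$. A site $v$ is unstable if $c(v)\ge C(v)$; when it topples, some rule $t\in T(v)$ is chosen arbitrarily, $v$ loses $C(v)$ particles, and each element of $t$ gains one particle per occurrence in $t$ (the remaining $C(v)-|t|$ particles go to the sink). A configuration $c_f$ is reachable from $c_i$ if there is a way of adding particles to $c_i$ at some sites and choosing topplings (of unstable sites, with choices of rules) whose result is $c_f$. $c_{\max}$ is the configuration with $c_{\max}(v) = C(v)-1$ for all $v$. A configuration is recurrent iff it is reachable from $c_{\max}$, and transient (forbidden) otherwise. -}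

module Defs where

open import Data.Nat using (ℕ; zero; suc; _+_; _∸_; _≤_; _<_)
open import Data.Fin using (Fin; zero; suc)
open import Data.Fin.Properties using (_≟_)
open import Data.List using (List)
open import Data.List.Membership.Propositional using (_∈_)
open import Data.Product using (Σ; ∃; ∃-syntax; _×_; _,_)
open import Relation.Nullary using (¬_; yes; no)
open import Relation.Binary.PropositionalEquality using (_≡_)
open import Relation.Binary.Construct.Closure.ReflexiveTransitive using (Star)

Σᶠ : ∀ {n} → (Fin n → ℕ) → ℕ
Σᶠ {zero}  f = 0
Σᶠ {suc n} f = f zero + Σᶠ (λ i → f (suc i))

-- Vertices of G are Fin (suc n): the sink is 'zero', ordinary site i is 'suc i'.
Vertex : ℕ → Set
Vertex n = Fin (suc n)

sink : ∀ {n} → Vertex n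
sink = zero

ord : ∀ {n} → Fin n → Vertex n
ord = suc

data Path {n : ℕ} (E : Vertex n → Vertex n → ℕ) : Vertex n → Vertex n → Set where
  here : ∀ {x} → Path E x x
  step : ∀ {x y z} → 0 < E x y → Path E y z → Path E x z

Connected : ∀ {n} → (Vertex n → Vertex n → ℕ) → Set
Connected {n} E = ∀ (x y : Vertex n) → Path E x y

-- A multiset of ordinary sites, given by its multiplicity function.
Multiset : ℕ → Set
Multiset n = Fin n → ℕ

size : ∀ {n} → Multiset n → ℕ
size = Σᶠ

Configuration : ℕ → Set
Configuration n = Fin n → ℕ

record Sandpile (n : ℕ) : Set where
  field
    E    : Vertex n → Vertex n → ℕ
    E-sym : ∀ x y → E x y ≡ E y x
    connected : Connected E
    C    : Fin n → ℕ
    C-pos : ∀ v → 0 < C v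
    T    : Fin n → List (Multiset n)
    rule-nbr  : ∀ v t → t ∈ T v → ∀ u → 0 < t u → 0 < E (ord v) (ord u)
    rule-size : ∀ v t → t ∈ T v → size t ≤ C v
    -- every edge incident to v appears in some rule of T(v):
    -- edges to ordinary neighbours u appear as occurrences of u,
    edge-ord  : ∀ v u → 0 < E (ord v) (ord u) → ∃[ t ] (t ∈ T v × 0 < t u)
    -- edges to the sink appear as a rule sending some particle to the sink.
    edge-sink : ∀ v → 0 < E (ord v) sink → ∃[ t ] (t ∈ T v × size t < C v)

module _ {n : ℕ} (S : Sandpile n) where
  open Sandpile S

  Irreducible : Set
  Irreducible = ∀ v t → t ∈ T v → 0 < size t

  at : Fin n → ℕ → Fin n → ℕ
  at v a w with w ≟ v
  ... | yes _ = a
  ... | no  _ = 0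

  data Move (c c' : Configuration n) : Set where
    add    : (v : Fin n) → (∀ w → c' w ≡ c w + at v 1 w) → Move c c'
    topple : (v : Fin n) (t : Multiset n) → t ∈ T v → C v ≤ c v →
             (∀ w → c' w + at v (C v) w ≡ c w + t w) → Move c c'

  Reachable : Configuration n → Configuration n → Set
  Reachable ci cf = Star Move ci cf

  cmax : Configuration n
  cmax v = C v ∸ 1

  Recurrent : Configuration n → Set
  Recurrent c = Reachable cmax c

  Transient : Configuration n → Set
  Transient c = ¬ Recurrent c

empty : ∀ {n} → Configuration n
empty _ = 0

module Submission where

-- Idea: call a configuration *occupied* if some ordinary site carries a
-- particle.  Every elementary move preserves occupation:
--   * adding a particle only increases every site;
--   * toppling v with rule t leaves at least t(u) particles on every site u
--     (on u = v because v held at least C(v) particles before toppling), and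
--     irreducibility guarantees t(u) > 0 for some u.
-- Hence every configuration reachable from an occupied one is occupied.
-- Finally c_max is occupied: the sink has an ordinary neighbour v (the graph
-- is connected and n ≥ 1), so some rule t of v sends a particle to the sink,
-- whence 1 ≤ |t| < C(v) and c_max(v) = C(v) - 1 > 0.  The empty
-- configuration is not occupied, so it is not reachable from c_max.

open import Defs
open import Data.Nat using (ℕ; zero; suc; _+_; _≤_; _<_; z≤n; s≤s)
open import Data.Nat.Properties
  using (≤-trans; <-≤-trans; +-comm; +-cancelʳ-≤; +-monoʳ-≤; m≤m+n; suc[m]≤n⇒m≤pred[n]; module ≤-Reasoning)
open import Data.Fin using (Fin; zero; suc)
open import Data.Fin.Properties using (_≟_)
open import Data.Product using (∃-syntax; _,_)
open import Relation.Nullary using (yes; no)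
open import Relation.Binary.PropositionalEquality using (_≡_; refl; sym; subst)
open import Relation.Binary.Construct.Closure.ReflexiveTransitive using (ε; _◅_)

Σᶠ-positive : ∀ {n} (f : Fin n → ℕ) → 0 < Σᶠ f → ∃[ i ] (0 < f i)
Σᶠ-positive {suc _} f sum>0 with f zero in f0
... | suc _ = zero , subst (0 <_) (sym f0) (s≤s z≤n)
... | zero with Σᶠ-positive (λ i → f (suc i)) sum>0
...   | i , fi>0 = suc i , fi>0

sink-neighbour-on-path : ∀ {n} {E : Vertex n → Vertex n → ℕ} {i : Fin n} →
                         Path E sink (ord i) → ∃[ v ] (0 < E sink (ord v))
sink-neighbour-on-path (step {y = zero}  _    rest) = sink-neighbour-on-path rest
sink-neighbour-on-path (step {y = suc v} edge _)    = v , edge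

sink-neighbour : ∀ {n} (E : Vertex n → Vertex n → ℕ) → Connected E → 1 ≤ n →
                 ∃[ v ] (0 < E sink (ord v))
sink-neighbour {suc _} E connected _ = sink-neighbour-on-path (connected sink (ord zero))

module _ {n : ℕ} (S : Sandpile n) where
  open Sandpile S

  Occupied : Configuration n → Set
  Occupied c = ∃[ w ] (0 < c w)

  at-≤ : ∀ (c : Configuration n) v a → a ≤ c v → ∀ u → at S v a u ≤ c u
  at-≤ c v a a≤cv u with u ≟ v
  ... | yes refl = a≤cv
  ... | no  _    = z≤n

  add-increases : ∀ {c c' : Configuration n} v →
                  (∀ w → c' w ≡ c w + at S v 1 w) → ∀ w → c w ≤ c' w
  add-increases {c} v c'≡ w = subst (c w ≤_) (sym (c'≡ w)) (m≤m+n (c w) _)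

  -- After toppling v with rule t, every site u holds at least t(u) particles:
  -- from c'(u) + [u = v]·C(v) = c(u) + t(u) and [u = v]·C(v) ≤ c(u).
  topple-leaves-rule : ∀ {c c' : Configuration n} v (t : Multiset n) → C v ≤ c v →
                       (∀ w → c' w + at S v (C v) w ≡ c w + t w) → ∀ u → t u ≤ c' u
  topple-leaves-rule {c} {c'} v t unstable c'≡ u =
    +-cancelʳ-≤ (at S v (C v) u) (t u) (c' u) (begin
      t u + at S v (C v) u ≤⟨ +-monoʳ-≤ (t u) (at-≤ c v (C v) unstable u) ⟩
      t u + c u            ≡⟨ +-comm (t u) (c u) ⟩
      c u + t u            ≡⟨ sym (c'≡ u) ⟩
      c' u + at S v (C v) u ∎)
    where open ≤-Reasoning

  module _ (irreducible : Irreducible S) where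

    move-preserves-occupied : ∀ {c c'} → Move S c c' → Occupied c → Occupied c'
    move-preserves-occupied (add v c'≡) (w , cw>0) =
      w , <-≤-trans cw>0 (add-increases v c'≡ w)
    move-preserves-occupied (topple v t t∈Tv unstable c'≡) _
      with Σᶠ-positive t (irreducible v t t∈Tv)
    ... | u , tu>0 = u , <-≤-trans tu>0 (topple-leaves-rule v t unstable c'≡ u)

    reachable-preserves-occupied : ∀ {c c'} → Reachable S c c' → Occupied c → Occupied c'
    reachable-preserves-occupied ε              occ = occ
    reachable-preserves-occupied (move ◅ moves) occ =
      reachable-preserves-occupied moves (move-preserves-occupied move occ)

    -- c_max is occupied: a sink neighbour v has a rule t with 1 ≤ |t| < C(v).
    cmax-occupied : 1 ≤ n → Occupied (cmax S)
    cmax-occupied 1≤n with sink-neighbour E connected 1≤n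
    ... | v , edge with edge-sink v (subst (0 <_) (E-sym sink (ord v)) edge)
    ...   | t , t∈Tv , |t|<Cv = v , ≤-trans (irreducible v t t∈Tv) (suc[m]≤n⇒m≤pred[n] |t|<Cv)

mainTheorem2 : ∀ (n : ℕ) → 1 ≤ n → (S : Sandpile n) → Irreducible S → Transient S empty
mainTheorem2 n 1≤n S irreducible cmax↝empty
  with reachable-preserves-occupied S irreducible cmax↝empty (cmax-occupied S irreducible 1≤n)
... | _ , ()
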